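{- Let $\lambda,\mu$ be integer partitions with $\lambda_i\ge\mu_i$ for all $i$, and let $\mathbf{w},\mathbf{w}'$ be integer compositions with $\mathbf{w}'\le_{\mathrm{ref}}\mathbf{w}$. If $\mathcal{P}_{\lambda/\mu,\mathbf{w}'}$ has the integer decomposition property, then $\mathcal{P}_{\lambda/\mu,\mathbf{w}}$ also has the integer decomposition property.
   Context: An integer composition is a finite sequence of positive integers; $\mathbf{w}'\le_{\mathrm{ref}}\mathbf{w}$ means $\mathbf{w}'$ is a refinement of $\mathbf{w}$, i.e. $\mathbf{w}$ is obtained from $\mathbf{w}'$ by adding together consecutive blocks of parts. For a composition $\mathbf{w}=(w_1,\dots,w_{m-1})$, a Gelfand--Tsetlin (GT) pattern is a real array $(x^i_j)_{1\le i\le m,\,1\le j\le n}$ ($n$ at least the length of $\lambda$, partitions padded with zeros) with $x^{i+1}_j\ge x^i_j$ and $x^i_j\ge x^{i+1}_{j+1}$ whenever defined; $\mathcal{P}_{\lambda/\mu,\mathbf{w}}\subset\mathbb{R}^{mn}$ is the polytope of GT patterns with $\mathbf{x}^m=\lambda$, $\mathbf{x}^1=\mu$, and $\sum_jx^{i+1}_j-\sum_jx^i_j=w_i$ for $i=1,\dots,m-1$. An integral polytope $Q\subset\mathbb{R}^d$ (all vertices lattice points) has the integer decomposition property if for every positive integer $k$ and every $\mathbf{x}\in kQ\cap\mathbb{Z}^d$ there are $\mathbf{x}^1,\dots,\mathbf{x}^k\in Q\cap\mathbb{Z}^d$ with $\mathbf{x}^1+\dots+\mathbf{x}^k=\mathbf{x}$.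 Note $k\mathcal{P}_{\lambda/\mu,\mathbf{w}}=\mathcal{P}_{k\lambda/k\mu,k\mathbf{w}}$. -}

module Defs where

open import Data.Nat as ℕ using (ℕ; zero; suc)
open import Data.Integer as ℤ using (ℤ; +_)
open import Data.Fin using (Fin; zero; suc; inject₁; fromℕ; toℕ)
open import Data.List using (List; []; _∷_; _++_; length; lookup)
open import Data.Nat.ListAction using (sum)
open import Data.List.Relation.Unary.All using (All)
open import Data.Product using (Σ; _×_)
open import Relation.Binary.PropositionalEquality using (_≡_)

sumFin : ∀ {k : ℕ} → (Fin k → ℤ) → ℤ
sumFin {zero}  f = + 0
sumFin {suc k} f = f zero ℤ.+ sumFin (λ t → f (suc t))

-- A partition padded with zeros to length n: weakly decreasing ℕ-valued vector.
IsPartition : ∀ {n : ℕ} → (Fin n → ℕ) → Set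
IsPartition {n} p = ∀ (i j : Fin n) → toℕ i ℕ.≤ toℕ j → p j ℕ.≤ p i

IsComposition : List ℕ → Set
IsComposition w = All (λ a → 0 ℕ.< a) w

data _≤ref_ : List ℕ → List ℕ → Set where
  ref-[] : [] ≤ref []
  ref-∷  : ∀ (b rest : List ℕ) (a : ℕ) (ws : List ℕ)
           → 0 ℕ.< length b → sum b ≡ a → rest ≤ref ws
           → (b ++ rest) ≤ref (a ∷ ws)

-- An (integer) array with m = suc L rows (row index zero = row 1,
-- row index fromℕ L = row m) and n columns: x i j = x^{i}_{j}.
Array : ℕ → ℕ → Set
Array L n = Fin (suc L) → Fin n → ℤ

InGT : ∀ {n L : ℕ} → (lam mu : Fin n → ℤ) → (w : Fin L → ℤ) → Array L n → Set
InGT {n} {L} lam mu w x =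
    (∀ (i : Fin L) (j : Fin n) → x (inject₁ i) j ℤ.≤ x (suc i) j)
  × (∀ (i : Fin L) (j j' : Fin n) → toℕ j' ≡ suc (toℕ j) → x (suc i) j' ℤ.≤ x (inject₁ i) j)
  × (∀ (j : Fin n) → x (fromℕ L) j ≡ lam j)
  × (∀ (j : Fin n) → x zero j ≡ mu j)
  × (∀ (i : Fin L) → sumFin (x (suc i)) ℤ.- sumFin (x (inject₁ i)) ≡ w i)

scale : ∀ {n : ℕ} → ℕ → (Fin n → ℤ) → (Fin n → ℤ)
scale k f j = + k ℤ.* f j

-- Integer decomposition property of P_{lam/mu,w}, using k P_{lam/mu,w} = P_{k lam/k mu,k w}:
-- every lattice point of the k-th dilate is a sum of k lattice points of P.
HasIDP : ∀ {n L : ℕ} → (lam mu : Fin n → ℤ) → (w : Fin L → ℤ) → Set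
HasIDP {n} {L} lam mu w =
  ∀ (k : ℕ) → 1 ℕ.≤ k → ∀ (x : Array L n) → InGT (scale k lam) (scale k mu) (scale k w) x
  → Σ (Fin k → Array L n) (λ xs →
       (∀ (t : Fin k) → InGT lam mu w (xs t))
     × (∀ (i : Fin (suc L)) (j : Fin n) → sumFin (λ t → xs t i j) ≡ x i j))

toℤvec : ∀ {n : ℕ} → (Fin n → ℕ) → (Fin n → ℤ)
toℤvec f j = + (f j)

compVec : (w : List ℕ) → Fin (length w) → ℤ
compVec w i = + (lookup w i)

module Submission where

-- A pattern of P_{λ/μ,w} is a chain of rows x¹ = μ, …, x^m = λ in which
-- consecutive rows interlace and the row sums grow by the parts of w.
-- Coarsening w' to w merges consecutive parts a, c into a + c, i.e. forgets
-- a row.  The proof runs in the opposite direction: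
--   * (row insertion) between two interlacing rows A ≤ C whose sums differ
--     by d₁ + d₂ one can insert a row R, interlacing with both, with sum gain
--     d₁ then d₂, chosen "staircase": in every pair of adjacent columns
--     j, j+1 either R_j = A_j or R_{j+1} = C_{j+1}.  R is obtained by
--     greedily filling the gaps C - A from the last column backwards;
--   * (row deletion) if a sum of k chains A_t ≤ R_t ≤ C_t has a staircase
--     middle row, then deleting the middle rows keeps every chain
--     interlacing, because equality of sums forces equality of summands.
-- Given x ∈ kP_{λ/μ,w} we insert rows to get y ∈ kP_{λ/μ,w'}, decompose y
-- by the IDP of P_{λ/μ,w'}, and delete the inserted rows from each summand.

open import Defs
open import Data.Nat using (ℕ; _≤_)
open import Data.Fin using (Fin)
open import Data.List using (List)

open import Data.Nat as ℕ using (zero; suc; _⊓_; _∸_; _<_; z≤n; s≤s)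
import Data.Nat.Properties as ℕP
open import Data.Integer as ℤ using (ℤ; +_; ∣_∣)
import Data.Integer.Properties as ℤP
open import Data.Integer.Tactic.RingSolver using (solve-∀)
open import Data.Fin using (zero; suc; toℕ; inject₁; fromℕ)
open import Data.List using ([]; _∷_; _++_; length)
open import Data.Nat.ListAction using (sum)
open import Data.Product using (Σ; _×_; _,_; proj₁; proj₂)
open import Data.Sum using (_⊎_; inj₁; inj₂)
open import Data.Empty using (⊥-elim)
open import Function using (_∘_)
open import Relation.Binary.PropositionalEquality
import Algebra.Properties.CommutativeMonoid.Sum as MonoidSum
open import Algebra.Properties.CommutativeSemigroup ℤP.+-commutativeSemigroup using (interchange)

module ℕΣ = MonoidSum ℕP.+-0-commutativeMonoid

Σℕ : ∀ {n} → (Fin n → ℕ) → ℕ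
Σℕ = ℕΣ.sum

sumFin-cong : ∀ {k} {f g : Fin k → ℤ} → (∀ t → f t ≡ g t) → sumFin f ≡ sumFin g
sumFin-cong {zero}  f≗g = refl
sumFin-cong {suc k} f≗g = cong₂ ℤ._+_ (f≗g zero) (sumFin-cong (f≗g ∘ suc))

sumFin-+ : ∀ {k} (f g : Fin k → ℤ) → sumFin (λ t → f t ℤ.+ g t) ≡ sumFin f ℤ.+ sumFin g
sumFin-+ {zero}  f g = refl
sumFin-+ {suc k} f g = trans (cong (λ s → (f zero ℤ.+ g zero) ℤ.+ s) (sumFin-+ (f ∘ suc) (g ∘ suc)))
                             (interchange (f zero) (g zero) (sumFin (f ∘ suc)) (sumFin (g ∘ suc)))

sumFin-pos : ∀ {n} (e : Fin n → ℕ) → sumFin (λ j → + e j) ≡ + Σℕ e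
sumFin-pos {zero}  e = refl
sumFin-pos {suc n} e = cong (λ s → + e zero ℤ.+ s) (sumFin-pos (e ∘ suc))

sumFin-mono : ∀ {k} {f g : Fin k → ℤ} → (∀ t → f t ℤ.≤ g t) → sumFin f ℤ.≤ sumFin g
sumFin-mono {zero}  f≤g = ℤP.≤-refl
sumFin-mono {suc k} f≤g = ℤP.+-mono-≤ (f≤g zero) (sumFin-mono (f≤g ∘ suc))

+-tight : ∀ {a b c d : ℤ} → a ℤ.≤ b → c ℤ.≤ d → a ℤ.+ c ≡ b ℤ.+ d → a ≡ b × c ≡ d
+-tight a≤b c≤d eq =
    ℤP.≤-antisym a≤b (ℤP.≮⇒≥ λ a<b → ℤP.<-irrefl eq (ℤP.+-mono-<-≤ a<b c≤d))
  , ℤP.≤-antisym c≤d (ℤP.≮⇒≥ λ c<d → ℤP.<-irrefl eq (ℤP.+-mono-≤-< a≤b c<d))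

sumFin-tight : ∀ {k} {f g : Fin k → ℤ} → (∀ t → f t ℤ.≤ g t) → sumFin f ≡ sumFin g
             → ∀ t → f t ≡ g t
sumFin-tight {suc k} f≤g eq zero    = proj₁ (+-tight (f≤g zero) (sumFin-mono (f≤g ∘ suc)) eq)
sumFin-tight {suc k} f≤g eq (suc t) =
  sumFin-tight (f≤g ∘ suc) (proj₂ (+-tight (f≤g zero) (sumFin-mono (f≤g ∘ suc)) eq)) t

-- Given capacities δ and a demand D, fill δ D pours D
-- units into the columns starting from the last one, each column taking
-- as much as its capacity allows; spill δ D is what does not fit.
spill : ∀ {n} → (Fin n → ℕ) → ℕ → ℕ
spill {zero}  δ D = D
spill {suc n} δ D = spill (δ ∘ suc) D ∸ δ zero

fill : ∀ {n} → (Fin n → ℕ) → ℕ → Fin n → ℕ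
fill {suc n} δ D zero    = δ zero ⊓ spill (δ ∘ suc) D
fill {suc n} δ D (suc j) = fill (δ ∘ suc) D j

fill-≤ : ∀ {n} (δ : Fin n → ℕ) D j → fill δ D j ≤ δ j
fill-≤ δ D zero    = ℕP.m⊓n≤m (δ zero) _
fill-≤ δ D (suc j) = fill-≤ (δ ∘ suc) D j

fill-conserves : ∀ {n} (δ : Fin n → ℕ) D → Σℕ (fill δ D) ℕ.+ spill δ D ≡ D
fill-conserves {zero}  δ D = refl
fill-conserves {suc n} δ D = begin
  (d ⊓ s ℕ.+ S) ℕ.+ (s ∸ d) ≡⟨ ℕP.+-assoc (d ⊓ s) S (s ∸ d) ⟩
  d ⊓ s ℕ.+ (S ℕ.+ (s ∸ d)) ≡⟨ cong (d ⊓ s ℕ.+_) (ℕP.+-comm S (s ∸ d)) ⟩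
  d ⊓ s ℕ.+ ((s ∸ d) ℕ.+ S) ≡⟨ ℕP.+-assoc (d ⊓ s) (s ∸ d) S ⟨
  (d ⊓ s ℕ.+ (s ∸ d)) ℕ.+ S ≡⟨ cong (ℕ._+ S) (ℕP.m⊓n+n∸m≡n d s) ⟩
  s ℕ.+ S                   ≡⟨ ℕP.+-comm s S ⟩
  S ℕ.+ s                   ≡⟨ fill-conserves (δ ∘ suc) D ⟩
  D                         ∎
  where
  open ≡-Reasoning
  d = δ zero
  s = spill (δ ∘ suc) D
  S = Σℕ (fill (δ ∘ suc) D)

fill-saturated : ∀ {n} (δ : Fin n → ℕ) D → 0 < spill δ D → ∀ j → fill δ D j ≡ δ j
fill-saturated {suc n} δ D spilled j = saturated j
  where
  d<s : δ zero < spill (δ ∘ suc) D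
  d<s = ℕP.m∸n≢0⇒n<m (ℕP.m>n⇒m∸n≢0 spilled)
  saturated : ∀ j → fill δ D j ≡ δ j
  saturated zero    = ℕP.m≤n⇒m⊓n≡m (ℕP.<⇒≤ d<s)
  saturated (suc j) = fill-saturated (δ ∘ suc) D (ℕP.≤-<-trans z≤n d<s) j

-- The filled region is a final segment of columns: of two adjacent columns,
-- either the left one is empty or the right one is full.
fill-staircase : ∀ {n} (δ : Fin n → ℕ) D (j j' : Fin n) → toℕ j' ≡ suc (toℕ j)
               → fill δ D j ≡ 0 ⊎ fill δ D j' ≡ δ j'
fill-staircase {suc n} δ D zero (suc j') _ with spill (δ ∘ suc) D in spilled
... | zero  = inj₁ (ℕP.⊓-zeroʳ (δ zero))
... | suc _ = inj₂ (fill-saturated (δ ∘ suc) D (subst (0 <_) (sym spilled) (s≤s z≤n)) j')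
fill-staircase {suc n} δ D (suc j) (suc j') adjacent =
  fill-staircase (δ ∘ suc) D j j' (ℕP.suc-injective adjacent)

fill-exact : ∀ {n} (δ : Fin n → ℕ) D → D ≤ Σℕ δ → Σℕ (fill δ D) ≡ D
fill-exact δ D D≤Σδ with spill δ D in spilled
... | zero  = begin
  Σℕ (fill δ D)                  ≡⟨ ℕP.+-identityʳ _ ⟨
  Σℕ (fill δ D) ℕ.+ 0            ≡⟨ cong (Σℕ (fill δ D) ℕ.+_) spilled ⟨
  Σℕ (fill δ D) ℕ.+ spill δ D    ≡⟨ fill-conserves δ D ⟩
  D                              ∎
  where open ≡-Reasoning
... | suc s = ⊥-elim (ℕP.<-irrefl refl (begin-strict
  Σℕ δ                           <⟨ ℕP.m<m+n (Σℕ δ) (s≤s z≤n) ⟩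
  Σℕ δ ℕ.+ suc s                 ≡⟨ cong (ℕ._+ suc s) full ⟨
  Σℕ (fill δ D) ℕ.+ suc s        ≡⟨ cong (Σℕ (fill δ D) ℕ.+_) spilled ⟨
  Σℕ (fill δ D) ℕ.+ spill δ D    ≡⟨ fill-conserves δ D ⟩
  D                              ≤⟨ D≤Σδ ⟩
  Σℕ δ                           ∎))
  where
  open ℕP.≤-Reasoning
  full : Σℕ (fill δ D) ≡ Σℕ δ
  full = ℕΣ.sum-cong-≗ (fill-saturated δ D (subst (0 <_) (sym spilled) (s≤s z≤n)))

Row : ℕ → Set
Row n = Fin n → ℤ

-- b can sit directly above a in a GT pattern, with row-sum gain w.
record Step {n} (w : ℤ) (a b : Row n) : Set where
  field
    rises      : ∀ j → a j ℤ.≤ b j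
    interlaces : ∀ j j' → toℕ j' ≡ suc (toℕ j) → b j' ℤ.≤ a j
    gains      : sumFin b ℤ.- sumFin a ≡ w
open Step

Step-congʳ : ∀ {n w} {a b b' : Row n} → (∀ j → b j ≡ b' j) → Step w a b → Step w a b'
Step-congʳ {a = a} b≗b' a→b = record
  { rises      = λ j → subst (a j ℤ.≤_) (b≗b' j) (rises a→b j)
  ; interlaces = λ j j' adj → subst (ℤ._≤ a j) (b≗b' j') (interlaces a→b j j' adj)
  ; gains      = subst (λ s → s ℤ.- sumFin a ≡ _) (sumFin-cong b≗b') (gains a→b)
  }

reweigh : ∀ {n u v} {a b : Row n} → u ≡ v → Step u a b → Step v a b
reweigh refl a→b = a→b

Staircase : ∀ {n} → Row n → Row n → Row n → Set
Staircase A R C = ∀ j j' → toℕ j' ≡ suc (toℕ j) → R j ≡ A j ⊎ R j' ≡ C j'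

RowSum : ∀ {n k} → (Fin k → Row n) → Row n → Set
RowSum Xs X = ∀ j → sumFin (λ t → Xs t j) ≡ X j

add-sub : ∀ a x → (a ℤ.+ x) ℤ.- a ≡ x
add-sub = solve-∀

add-back : ∀ a c → c ≡ a ℤ.+ (c ℤ.- a)
add-back = solve-∀

sub-via : ∀ a r c → c ℤ.- r ≡ (c ℤ.- a) ℤ.- (r ℤ.- a)
sub-via = solve-∀

≤⇒gap : ∀ {i j} → i ℤ.≤ j → j ≡ i ℤ.+ + ∣ j ℤ.- i ∣
≤⇒gap {i} {j} i≤j = begin
  j                       ≡⟨ add-back i j ⟩
  i ℤ.+ (j ℤ.- i)         ≡⟨ cong (λ s → i ℤ.+ s) (ℤP.0≤i⇒+∣i∣≡i (ℤP.i≤j⇒0≤j-i i≤j)) ⟨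
  i ℤ.+ + ∣ j ℤ.- i ∣     ∎
  where open ≡-Reasoning

-- Row insertion: a step of gain d₁ + d₂ factors through a staircase row,
-- obtained by filling d₁ units greedily into the gaps C - A.
insert-row : ∀ {n} (d₁ d₂ : ℕ) (A C : Row n) → Step (+ (d₁ ℕ.+ d₂)) A C
           → Σ (Row n) λ R → Step (+ d₁) A R × Step (+ d₂) R C × Staircase A R C
insert-row {n} d₁ d₂ A C A→C = R , A→R , R→C , staircase
  where
  δ : Fin n → ℕ
  δ j = ∣ C j ℤ.- A j ∣
  C≡A+δ : ∀ j → C j ≡ A j ℤ.+ + δ j
  C≡A+δ j = ≤⇒gap (rises A→C j)
  raise-gain : ∀ (e : Fin n → ℕ) → sumFin (λ j → A j ℤ.+ + e j) ℤ.- sumFin A ≡ + Σℕ e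
  raise-gain e = trans
    (cong (ℤ._- sumFin A) (trans (sumFin-+ A (λ j → + e j)) (cong (λ s → sumFin A ℤ.+ s) (sumFin-pos e))))
    (add-sub (sumFin A) (+ Σℕ e))
  Σδ : Σℕ δ ≡ d₁ ℕ.+ d₂
  Σδ = ℤP.+-injective (trans (sym (raise-gain δ))
         (trans (cong (ℤ._- sumFin A) (sym (sumFin-cong C≡A+δ))) (gains A→C)))
  e : Fin n → ℕ
  e = fill δ d₁
  R : Row n
  R j = A j ℤ.+ + e j
  A≤R : ∀ j → A j ℤ.≤ R j
  A≤R j = ℤP.i≤i+j (A j) (+ e j)
  R≤C : ∀ j → R j ℤ.≤ C j
  R≤C j = subst (R j ℤ.≤_) (sym (C≡A+δ j)) (ℤP.+-monoʳ-≤ (A j) (ℤ.+≤+ (fill-≤ δ d₁ j)))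
  gainR : sumFin R ℤ.- sumFin A ≡ + d₁
  gainR = trans (raise-gain e) (cong +_ (fill-exact δ d₁ (subst (d₁ ≤_) (sym Σδ) (ℕP.m≤m+n d₁ d₂))))
  A→R : Step (+ d₁) A R
  A→R = record
    { rises      = A≤R
    ; interlaces = λ j j' adj → ℤP.≤-trans (R≤C j') (interlaces A→C j j' adj)
    ; gains      = gainR
    }
  R→C : Step (+ d₂) R C
  R→C = record
    { rises      = R≤C
    ; interlaces = λ j j' adj → ℤP.≤-trans (interlaces A→C j j' adj) (A≤R j)
    ; gains      = begin
        sumFin C ℤ.- sumFin R                                      ≡⟨ sub-via (sumFin A) (sumFin R) (sumFin C) ⟩
        (sumFin C ℤ.- sumFin A) ℤ.- (sumFin R ℤ.- sumFin A)        ≡⟨ cong₂ ℤ._-_ (gains A→C) gainR ⟩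
        + (d₁ ℕ.+ d₂) ℤ.- + d₁                                     ≡⟨ cong (ℤ._- + d₁) (ℤP.pos-+ d₁ d₂) ⟩
        (+ d₁ ℤ.+ + d₂) ℤ.- + d₁                                   ≡⟨ add-sub (+ d₁) (+ d₂) ⟩
        + d₂                                                       ∎
    }
    where open ≡-Reasoning
  staircase : Staircase A R C
  staircase j j' adj with fill-staircase δ d₁ j j' adj
  ... | inj₁ empty = inj₁ (trans (cong (λ s → A j ℤ.+ + s) empty) (ℤP.+-identityʳ (A j)))
  ... | inj₂ full  = inj₂ (trans (cong (λ s → A j' ℤ.+ + s) full) (sym (C≡A+δ j')))

-- Where
-- R agrees with A (or C), the inequalities As t ≤ Rs t (or Rs t ≤ Cs t)
-- have equal sums, hence are equalities, and interlacing passes through.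
delete-row : ∀ {n k} {u v : ℤ} (As Rs Cs : Fin k → Row n) {A R C : Row n}
           → (∀ t → Step u (As t) (Rs t)) → (∀ t → Step v (Rs t) (Cs t))
           → RowSum As A → RowSum Rs R → RowSum Cs C → Staircase A R C
           → ∀ t → Step (u ℤ.+ v) (As t) (Cs t)
delete-row {u = u} {v} As Rs Cs A→R R→C ΣA ΣR ΣC staircase t = record
  { rises      = λ j → ℤP.≤-trans (rises (A→R t) j) (rises (R→C t) j)
  ; interlaces = interlaces′
  ; gains      = begin
      sumFin (Cs t) ℤ.- sumFin (As t)
        ≡⟨ ℤP.+-minus-telescope (sumFin (Cs t)) (sumFin (Rs t)) (sumFin (As t)) ⟨
      (sumFin (Cs t) ℤ.- sumFin (Rs t)) ℤ.+ (sumFin (Rs t) ℤ.- sumFin (As t))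
        ≡⟨ cong₂ ℤ._+_ (gains (R→C t)) (gains (A→R t)) ⟩
      v ℤ.+ u
        ≡⟨ ℤP.+-comm v u ⟩
      u ℤ.+ v ∎
  }
  where
  open ≡-Reasoning
  interlaces′ : ∀ j j' → toℕ j' ≡ suc (toℕ j) → Cs t j' ℤ.≤ As t j
  interlaces′ j j' adj with staircase j j' adj
  ... | inj₁ R≡A = subst (Cs t j' ℤ.≤_) (sym (As≡Rs t)) (interlaces (R→C t) j j' adj)
    where
    As≡Rs : ∀ t → As t j ≡ Rs t j
    As≡Rs = sumFin-tight (λ t → rises (A→R t) j) (trans (ΣA j) (trans (sym R≡A) (sym (ΣR j))))
  ... | inj₂ R≡C = subst (ℤ._≤ As t j) (Rs≡Cs t) (interlaces (A→R t) j j' adj)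
    where
    Rs≡Cs : ∀ t → Rs t j' ≡ Cs t j'
    Rs≡Cs = sumFin-tight (λ t → rises (R→C t) j') (trans (ΣR j') (trans R≡C (sym (ΣC j'))))

data Merges : List ℕ → List ℕ → Set where
  done  : Merges [] []
  keep  : ∀ {a w' w} → Merges w' w → Merges (a ∷ w') (a ∷ w)
  merge : ∀ {a b c w' w} → Merges (b ∷ w') (c ∷ w) → Merges (a ∷ b ∷ w') ((a ℕ.+ c) ∷ w)

merge-block : ∀ b {rest ws} → 0 < length b → Merges rest ws → Merges (b ++ rest) (sum b ∷ ws)
merge-block (a ∷ [])     {rest} {ws} _ m =
  subst (λ s → Merges (a ∷ rest) (s ∷ ws)) (sym (ℕP.+-identityʳ a)) (keep m)
merge-block (a ∷ b ∷ bs) _ m = merge (merge-block (b ∷ bs) (s≤s z≤n) m)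

≤ref⇒Merges : ∀ {w' w} → w' ≤ref w → Merges w' w
≤ref⇒Merges ref-[] = done
≤ref⇒Merges (ref-∷ b rest _ ws nonempty refl w'≤w) = merge-block b nonempty (≤ref⇒Merges w'≤w)

-- The rows of a pattern for w correspond to some of the rows of a pattern
-- for w': row i for w is row coarsen p i for w'.
coarsen : ∀ {w' w} → Merges w' w → Fin (suc (length w)) → Fin (suc (length w'))
coarsen p         zero    = zero
coarsen (keep p)  (suc i) = suc (coarsen p i)
coarsen (merge p) (suc i) = suc (coarsen p (suc i))

coarsen-top : ∀ {w' w} (p : Merges w' w) → coarsen p (fromℕ (length w)) ≡ fromℕ (length w')
coarsen-top done      = refl
coarsen-top (keep p)  = cong suc (coarsen-top p)
coarsen-top (merge p) = cong suc (coarsen-top p)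

Steps : ∀ {L n} → (Fin L → ℤ) → Array L n → Set
Steps ω x = ∀ i → Step (ω i) (x (inject₁ i)) (x (suc i))

Boundary : ∀ {L n} → (lam mu : Fin n → ℤ) → Array L n → Set
Boundary {L} lam mu x = (∀ j → x (fromℕ L) j ≡ lam j) × (∀ j → x zero j ≡ mu j)

InGT⇒Steps : ∀ {L n} {lam mu : Fin n → ℤ} {ω : Fin L → ℤ} (x : Array L n)
           → InGT lam mu ω x → Steps ω x
InGT⇒Steps x (rise , interlace , _ , _ , gain) i = record
  { rises = rise i ; interlaces = interlace i ; gains = gain i }

InGT⇒Boundary : ∀ {L n} {lam mu : Fin n → ℤ} {ω : Fin L → ℤ} (x : Array L n)
              → InGT lam mu ω x → Boundary lam mu x
InGT⇒Boundary x (_ , _ , top , bottom , _) = top , bottom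

Steps⇒InGT : ∀ {L n} {lam mu : Fin n → ℤ} {ω : Fin L → ℤ} (x : Array L n)
           → Steps ω x → Boundary lam mu x → InGT lam mu ω x
Steps⇒InGT x steps (top , bottom) =
  (λ i → rises (steps i)) , (λ i → interlaces (steps i)) , top , bottom , (λ i → gains (steps i))

Boundary-coarsen : ∀ {w' w n} {lam mu : Fin n → ℤ} (p : Merges w' w)
                   {y : Array (length w') n} {x : Array (length w) n}
                 → (∀ i j → y (coarsen p i) j ≡ x i j) → Boundary lam mu y → Boundary lam mu x
Boundary-coarsen {w = w} p {y} y∘p≗x (top , bottom) =
    (λ j → trans (sym (y∘p≗x (fromℕ (length w)) j)) (trans (cong (λ i → y i j) (coarsen-top p)) (top j)))
  , (λ j → trans (sym (y∘p≗x zero j)) (bottom j))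

Boundary-refine : ∀ {w' w n} {lam mu : Fin n → ℤ} (p : Merges w' w)
                  {y : Array (length w') n} {x : Array (length w) n}
                → (∀ i j → y (coarsen p i) j ≡ x i j) → Boundary lam mu x → Boundary lam mu y
Boundary-refine {w = w} p {y} y∘p≗x (top , bottom) =
    (λ j → trans (cong (λ i → y i j) (sym (coarsen-top p))) (trans (y∘p≗x (fromℕ (length w)) j) (top j)))
  , (λ j → trans (y∘p≗x zero j) (bottom j))

Decomposes : ∀ {k L n} → (Fin k → Array L n) → Array L n → Set
Decomposes xs x = ∀ i j → sumFin (λ t → xs t i j) ≡ x i j

Coarsens : ∀ {n} (k : ℕ) {w' w} → Merges w' w → Array (length w') n → Set
Coarsens {n} k {w'} {w} p y =
  (ys : Fin k → Array (length w') n) → (∀ t → Steps (compVec w') (ys t))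
  → Decomposes ys y → ∀ t → Steps (compVec w) (ys t ∘ coarsen p)

record Refinement {n} (k : ℕ) {w' w} (p : Merges w' w) (x : Array (length w) n) : Set where
  field
    fine          : Array (length w') n
    fine-steps    : Steps (scale k (compVec w')) fine
    fine-extends  : ∀ i j → fine (coarsen p i) j ≡ x i j
    coarsening-ok : Coarsens k p fine
open Refinement

dilate-+ : ∀ k a c → + k ℤ.* + (a ℕ.+ c) ≡ + (k ℕ.* a ℕ.+ k ℕ.* c)
dilate-+ k a c = trans (sym (ℤP.pos-* k (a ℕ.+ c))) (cong +_ (ℕP.*-distribˡ-+ k a c))

-- Every dilated pattern can be refined: keep rows for kept parts, and insert
-- a staircase row for every merge.
refine : ∀ {n} (k : ℕ) {w' w} (p : Merges w' w) (x : Array (length w) n)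
       → Steps (scale k (compVec w)) x → Refinement k p x
refine k done x _ = record
  { fine = x ; fine-steps = λ () ; fine-extends = λ { zero j → refl } ; coarsening-ok = λ _ _ _ _ () }
refine {n} k (keep {a} {w'} p) x steps = record
  { fine = y ; fine-steps = y-steps ; fine-extends = y-extends ; coarsening-ok = ok }
  where
  R : Refinement k p (x ∘ suc)
  R = refine k p (x ∘ suc) (steps ∘ suc)
  y : Array (length (a ∷ w')) n
  y zero    = x zero
  y (suc i) = fine R i
  y-steps : Steps (scale k (compVec (a ∷ w'))) y
  y-steps zero    = Step-congʳ (λ j → sym (fine-extends R zero j)) (steps zero)
  y-steps (suc i) = fine-steps R i
  y-extends : ∀ i j → y (coarsen (keep p) i) j ≡ x i j
  y-extends zero    j = refl
  y-extends (suc i) j = fine-extends R i j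
  ok : Coarsens k (keep p) y
  ok ys ys-steps ys-sum t zero    = ys-steps t zero
  ok ys ys-steps ys-sum t (suc i) =
    coarsening-ok R (λ t → ys t ∘ suc) (λ t → ys-steps t ∘ suc) (ys-sum ∘ suc) t i
refine {n} k (merge {a} {b} {c} {w'} {w} p) x steps
  with insert-row (k ℕ.* a) (k ℕ.* c) (x zero) (x (suc zero)) (reweigh (dilate-+ k a c) (steps zero))
... | r , x₀→r , r→x₁ , staircase = record
  { fine = y ; fine-steps = y-steps ; fine-extends = y-extends ; coarsening-ok = ok }
  where
  x̃ : Array (length (c ∷ w)) n
  x̃ zero    = r
  x̃ (suc i) = x (suc i)
  x̃-steps : Steps (scale k (compVec (c ∷ w))) x̃
  x̃-steps zero    = reweigh (ℤP.pos-* k c) r→x₁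
  x̃-steps (suc i) = steps (suc i)
  R : Refinement k p x̃
  R = refine k p x̃ x̃-steps
  y : Array (length (a ∷ b ∷ w')) n
  y zero    = x zero
  y (suc i) = fine R i
  y-steps : Steps (scale k (compVec (a ∷ b ∷ w'))) y
  y-steps zero    = Step-congʳ (λ j → sym (fine-extends R zero j))
                      (reweigh (ℤP.pos-* k a) x₀→r)
  y-steps (suc i) = fine-steps R i
  y-extends : ∀ i j → y (coarsen (merge p) i) j ≡ x i j
  y-extends zero    j = refl
  y-extends (suc i) j = fine-extends R (suc i) j
  -- A decomposition of y, restricted to its rows ≥ 1, decomposes fine R.
  -- In the bottom step the summands pass through row 1 (summing to the
  -- staircase row r), which deleting the row removes.
  ok : Coarsens k (merge p) y
  ok ys ys-steps ys-sum t = λ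
    { zero    → reweigh (sym (ℤP.pos-+ a c))
                  (delete-row below middle above (λ t → ys-steps t zero) (λ t → upper t zero)
                              (ys-sum zero) middle-sum above-sum staircase t)
    ; (suc i) → upper t (suc i) }
    where
    upper : ∀ t → Steps (compVec (c ∷ w)) ((ys t ∘ suc) ∘ coarsen p)
    upper = coarsening-ok R (λ t → ys t ∘ suc) (λ t → ys-steps t ∘ suc) (ys-sum ∘ suc)
    below middle above : Fin k → Row n
    below  t = ys t zero
    middle t = ys t (suc zero)
    above  t = ys t (suc (coarsen p (suc zero)))
    middle-sum : RowSum middle r
    middle-sum j = trans (ys-sum (suc zero) j) (fine-extends R zero j)
    above-sum : RowSum above (x (suc zero))
    above-sum j = trans (ys-sum (suc (coarsen p (suc zero))) j) (fine-extends R (suc zero) j)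

Decomposition : ∀ {L n} (lam mu : Fin n → ℤ) (ω : Fin L → ℤ) (k : ℕ) → Array L n → Set
Decomposition {L} {n} lam mu ω k x =
  Σ (Fin k → Array L n) λ xs → (∀ t → InGT lam mu ω (xs t)) × Decomposes xs x

coarsen-decomposition : ∀ {n k w' w} {lam mu : Fin n → ℤ} (p : Merges w' w) {x : Array (length w) n}
                      → (R : Refinement k p x) → Decomposition lam mu (compVec w') k (fine R)
                      → Decomposition lam mu (compVec w) k x
coarsen-decomposition p R (ys , ys∈P' , ys-sum) =
    (λ t → ys t ∘ coarsen p)
  , (λ t → Steps⇒InGT (ys t ∘ coarsen p) (coarsening-ok R ys (λ t → InGT⇒Steps (ys t) (ys∈P' t)) ys-sum t)
                      (Boundary-coarsen p {y = ys t} (λ _ _ → refl) (InGT⇒Boundary (ys t) (ys∈P' t))))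
  , (λ i j → trans (ys-sum (coarsen p i) j) (fine-extends R i j))

-- The integer decomposition property is inherited by coarser compositions:
-- refine a lattice point of kP_{w}, decompose it in P_{w'}, coarsen back.
mainTheorem5 : ∀ (n : ℕ) (lam mu : Fin n → ℕ)
    → IsPartition lam → IsPartition mu → (∀ (j : Fin n) → mu j ≤ lam j)
    → ∀ (w w' : List ℕ) → IsComposition w → IsComposition w' → w' ≤ref w
    → HasIDP (toℤvec lam) (toℤvec mu) (compVec w')
    → HasIDP (toℤvec lam) (toℤvec mu) (compVec w)
mainTheorem5 n lam mu _ _ _ w w' _ _ w'≤w idp' k k≥1 x x∈kP =
  coarsen-decomposition p R (idp' k k≥1 (fine R) refinement∈kP')
  where
  p : Merges w' w
  p = ≤ref⇒Merges w'≤w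
  R : Refinement k p x
  R = refine k p x (InGT⇒Steps x x∈kP)
  refinement∈kP' : InGT (scale k (toℤvec lam)) (scale k (toℤvec mu)) (scale k (compVec w')) (fine R)
  refinement∈kP' = Steps⇒InGT (fine R) (fine-steps R) (Boundary-refine p {y = fine R} (fine-extends R) (InGT⇒Boundary x x∈kP))
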